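{- Let $G$ be a connected undirected graph with non-negative edge weights $w$, $\epsilon>0$, and $H$ the greedy $(1+\epsilon)$-spanner of $G$. Let $D$ be a subgraph of $G$ such that one can associate with every edge $e\in H\setminus D$ a cycle $C_e$ of $H$ containing $e$, with $\sum_{e\in H\setminus D}w(C_e)\le 2w(H)$. Then $w(H)\le\left(1+\frac{2}{\epsilon}\right)w(D)$.
   Context: For a set or subgraph $F$ of edges, $w(F)=\sum_{e\in F}w(e)$. The greedy $(1+\epsilon)$-spanner of $G=(V,E,w)$: sort the edges $e_1,\dots,e_m$ so that $w(e_1)\le\dots\le w(e_m)$ (ties in any order), start with $H=(V,\emptyset)$, and for $i=1,\dots,m$ add $e_i=(u_i,v_i)$ to $H$ if $d_H(u_i,v_i)>(1+\epsilon)w(e_i)$, where $d_H$ is the shortest-path distance in the current $H$ (infinite if disconnected). The greedy spanner is any output of this procedure.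
   Formalization: The edge weights $w$ and the parameter $\epsilon$ are rational rather than real. -}

module Defs where

open import Data.Nat using (ℕ; suc; _≤_)
open import Data.Fin using (Fin)
import Data.Fin as F
open import Data.Fin.Subset using (Subset; _∈_; _∉_)
open import Data.Fin.Subset.Properties using (_∈?_)
open import Data.Fin.Permutation using (Permutation′; _⟨$⟩ʳ_; _⟨$⟩ˡ_)
open import Data.Rational using (ℚ; 0ℚ; 1ℚ; _+_; _*_) renaming (_≤_ to _≤ℚ_)
open import Data.List using (List; []; _∷_; foldr; map; length)
open import Data.List.Membership.Propositional using () renaming (_∈_ to _∈ˡ_)
open import Data.List.Relation.Unary.Unique.Propositional using (Unique)
open import Data.Product using (Σ; _×_; _,_; proj₁; proj₂; ∃)
open import Data.Sum using (_⊎_)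
open import Data.Unit using (⊤)
open import Relation.Nullary using (¬_; yes; no)
open import Relation.Binary.PropositionalEquality using (_≡_)
open import Function.Bundles using (_⇔_)

-- A finite undirected (multi)graph on vertex set Fin n with m edges
-- indexed by Fin m; each edge has two endpoints and a rational weight.
record WGraph (n m : ℕ) : Set where
  field
    ends : Fin m → Fin n × Fin n
    w    : Fin m → ℚ
open WGraph public

module _ {n m : ℕ} (G : WGraph n m) where

  Joins : Fin m → Fin n → Fin n → Set
  Joins e u x = (ends G e ≡ (u , x)) ⊎ (ends G e ≡ (x , u))

  data Walk (E : Fin m → Set) : Fin n → Fin n → Set where
    nil  : ∀ {u} → Walk E u u
    cons : ∀ {u x v} (e : Fin m) → E e → Joins e u x → Walk E x v → Walk E u v

  walkEdges : ∀ {E u v} → Walk E u v → List (Fin m)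
  walkEdges nil = []
  walkEdges (cons e _ _ p) = e ∷ walkEdges p

  -- vertices visited, excluding the final endpoint
  walkVerts : ∀ {E u v} → Walk E u v → List (Fin n)
  walkVerts nil = []
  walkVerts (cons {u} e _ _ p) = u ∷ walkVerts p

  sumℚ : List ℚ → ℚ
  sumℚ = foldr _+_ 0ℚ

  walkWeight : ∀ {E u v} → Walk E u v → ℚ
  walkWeight p = sumℚ (map (w G) (walkEdges p))

  IsCycle : ∀ {E v} → Walk E v v → Set
  IsCycle p = (1 ≤ length (walkEdges p)) × Unique (walkEdges p) × Unique (walkVerts p)

  sumEdges : (Fin m → ℚ) → ℚ
  sumEdges f = sumℚ (map f (Data.List.allFin m))

  weight : Subset m → ℚ
  weight F = sumEdges wIf
    where
      wIf : Fin m → ℚ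
      wIf e with e ∈? F
      ... | yes _ = w G e
      ... | no  _ = 0ℚ

  sumDiff : Subset m → Subset m → (Fin m → ℚ) → ℚ
  sumDiff H D f = sumEdges g
    where
      g : Fin m → ℚ
      g e with e ∈? H | e ∈? D
      ... | yes _ | no _ = f e
      ... | _     | _    = 0ℚ

  Connected : Set
  Connected = ∀ u v → Walk (λ _ → ⊤) u v

  NonNegWeights : Set
  NonNegWeights = ∀ e → 0ℚ ≤ℚ w G e

  -- H is an output of the greedy (1+ε)-spanner procedure: there is an
  -- ordering σ of the edges, non-decreasing in weight (σ i is the edge
  -- processed at step i), such that the edge processed at step i is in H
  -- iff, in the graph H restricted to edges processed before step i,
  -- there is no walk between its endpoints of weight ≤ (1+ε)·w(e)
  -- (i.e. iff d_{H_i}(u,v) > (1+ε) w(e)).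
  IsGreedySpanner : ℚ → Subset m → Set
  IsGreedySpanner ε H =
    Σ (Permutation′ m) λ σ →
      (∀ i j → i F.≤ j → w G (σ ⟨$⟩ʳ i) ≤ℚ w G (σ ⟨$⟩ʳ j)) ×
      (∀ i → (σ ⟨$⟩ʳ i ∈ H) ⇔
         (¬ Σ (Walk (λ f → (f ∈ H) × (σ ⟨$⟩ˡ f F.< i))
                    (proj₁ (ends G (σ ⟨$⟩ʳ i))) (proj₂ (ends G (σ ⟨$⟩ʳ i))))
              (λ p → walkWeight p ≤ℚ ((1ℚ + ε) * w G (σ ⟨$⟩ʳ i)))))

{-# OPTIONS --safe #-}
-- Let x be the edge of a cycle C of H that the greedy algorithm processed last.
-- The rest of C joins the endpoints of x using earlier edges of H, and x was
-- nevertheless added, so w(C) − w(x) > (1+ε) w(x). As x is also the heaviest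
-- edge of C, every edge e of C satisfies (2+ε) w(e) ≤ w(C). Charging each
-- e ∈ H ∖ D to its cycle C_e gives
--   (2+ε) w(H) ≤ Σ_{e ∈ H∖D} w(C_e) + (2+ε) w(D) ≤ 2 w(H) + (2+ε) w(D),
-- that is ε w(H) ≤ (2+ε) w(D).
module Submission where

open import Defs
open import Data.Nat using (ℕ)
open import Data.Fin using (Fin)
open import Data.Fin.Subset using (Subset; _∈_; _∉_)
open import Data.Rational using (ℚ; 0ℚ; 1ℚ; _+_; _*_; _<_; _≤_; 1/_; >-nonZero)
open import Data.List.Membership.Propositional using () renaming (_∈_ to _∈ˡ_)
open import Data.Product using (Σ; _×_)

import Data.Fin as Fin
import Data.Fin.Properties as Finₚ
open import Data.Fin.Subset.Properties using (_∈?_)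
open import Data.Fin.Permutation using (Permutation′; _⟨$⟩ʳ_; _⟨$⟩ˡ_; inverseʳ)
open import Data.Rational using (-_; _-_; NonZero; NonNegative; positive)
import Data.Rational.Properties as ℚₚ
open import Data.Rational.Solver using (module +-*-Solver)
open import Data.List using (List; []; _∷_; [_]; _++_; foldr; map; allFin)
open import Data.List.Relation.Unary.Any using (here; there)
import Data.List.Relation.Unary.All as All
import Data.List.Relation.Unary.AllPairs as AllPairs
open import Data.List.Relation.Unary.Unique.Propositional using (Unique)
open import Data.List.Relation.Binary.Permutation.Propositional
  using (_↭_; ↭-refl; ↭-prep; ↭-sym; ↭⇒↭ₛ; module PermutationReasoning)
open import Data.List.Relation.Binary.Permutation.Propositional.Properties
  using (∈-resp-↭; shift; ++-comm)
import Data.List.Relation.Binary.Permutation.Propositional.Properties as ↭ₚ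
open import Data.List.Relation.Binary.Permutation.Setoid.Properties
  using (foldr-commMonoid; Unique-resp-↭)
import Data.List.Extrema
open import Data.Product using (_,_; proj₁; proj₂)
open import Data.Sum using (inj₁; inj₂)
open import Function using (_∘_; id)
open import Function.Bundles using (Equivalence)
open import Relation.Nullary using (¬_; yes; no)
open import Relation.Binary.PropositionalEquality
  using (_≡_; _≢_; refl; sym; trans; cong; cong₂; subst; subst₂; setoid; module ≡-Reasoning)

sum : List ℚ → ℚ
sum = foldr _+_ 0ℚ

sum-↭ : ∀ {xs ys} → xs ↭ ys → sum xs ≡ sum ys
sum-↭ xs↭ys = foldr-commMonoid (setoid ℚ) ℚₚ.+-0-isCommutativeMonoid (↭⇒↭ₛ xs↭ys)

module _ {A : Set} where

  sum-map-mono : ∀ {f g : A → ℚ} → (∀ x → f x ≤ g x) →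
                 ∀ xs → sum (map f xs) ≤ sum (map g xs)
  sum-map-mono f≤g []       = ℚₚ.≤-refl
  sum-map-mono f≤g (x ∷ xs) = ℚₚ.+-mono-≤ (f≤g x) (sum-map-mono f≤g xs)

  sum-map-*ˡ : ∀ c (f : A → ℚ) xs → sum (map (λ x → c * f x) xs) ≡ c * sum (map f xs)
  sum-map-*ˡ c f []       = sym (ℚₚ.*-zeroʳ c)
  sum-map-*ˡ c f (x ∷ xs) = begin
    c * f x + sum (map (λ x → c * f x) xs) ≡⟨ cong (c * f x +_) (sum-map-*ˡ c f xs) ⟩
    c * f x + c * sum (map f xs)           ≡⟨ ℚₚ.*-distribˡ-+ c (f x) _ ⟨
    c * (f x + sum (map f xs))             ∎
    where open ≡-Reasoning

  sum-map-+ : ∀ (f g : A → ℚ) xs →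
              sum (map (λ x → f x + g x) xs) ≡ sum (map f xs) + sum (map g xs)
  sum-map-+ f g []       = refl
  sum-map-+ f g (x ∷ xs) = begin
    (f x + g x) + sum (map (λ x → f x + g x) xs) ≡⟨ cong ((f x + g x) +_) (sum-map-+ f g xs) ⟩
    (f x + g x) + (sum (map f xs) + sum (map g xs))  ≡⟨ interchange (f x) (g x) _ _ ⟩
    (f x + sum (map f xs)) + (g x + sum (map g xs))  ∎
    where
    open ≡-Reasoning
    open +-*-Solver
    interchange : ∀ a b c d → (a + b) + (c + d) ≡ (a + c) + (b + d)
    interchange = solve 4 (λ a b c d → (a :+ b) :+ (c :+ d) := (a :+ c) :+ (b :+ d)) refl

module _ {n m : ℕ} (G : WGraph n m) where

  private
    variable
      E Q : Fin m → Set
      e f x : Fin m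
      u v a b : Fin n

  Joins-sym : Joins G e u v → Joins G e v u
  Joins-sym (inj₁ ends≡) = inj₂ ends≡
  Joins-sym (inj₂ ends≡) = inj₁ ends≡

  infixr 5 _++ʷ_

  _++ʷ_ : Walk G E u v → Walk G E v a → Walk G E u a
  nil           ++ʷ q = q
  cons e E j p  ++ʷ q = cons e E j (p ++ʷ q)

  walkEdges-++ʷ : (p : Walk G E u v) (q : Walk G E v a) →
                  walkEdges G (p ++ʷ q) ≡ walkEdges G p ++ walkEdges G q
  walkEdges-++ʷ nil            q = refl
  walkEdges-++ʷ (cons e _ _ p) q = cong (e ∷_) (walkEdges-++ʷ p q)

  reverseʷ : Walk G E u v → Walk G E v u
  reverseʷ nil             = nil
  reverseʷ (cons e Ee j p) = reverseʷ p ++ʷ cons e Ee (Joins-sym j) nil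

  walkEdges-reverseʷ : (p : Walk G E u v) → walkEdges G (reverseʷ p) ↭ walkEdges G p
  walkEdges-reverseʷ nil               = ↭-refl
  walkEdges-reverseʷ (cons e Ee j p)   = begin
    walkEdges G (reverseʷ p ++ʷ cons e Ee (Joins-sym j) nil) ≡⟨ walkEdges-++ʷ (reverseʷ p) _ ⟩
    walkEdges G (reverseʷ p) ++ [ e ]                       ↭⟨ ++-comm (walkEdges G (reverseʷ p)) _ ⟩
    e ∷ walkEdges G (reverseʷ p)                            ↭⟨ ↭-prep e (walkEdges-reverseʷ p) ⟩
    e ∷ walkEdges G p                                       ∎
    where open PermutationReasoning

  walkEdges-satisfy : (p : Walk G E u v) → f ∈ˡ walkEdges G p → E f
  walkEdges-satisfy (cons e Ee _ p) (here refl) = Ee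
  walkEdges-satisfy (cons e Ee _ p) (there f∈p) = walkEdges-satisfy p f∈p

  restrict : (p : Walk G E u v) → (∀ {f} → f ∈ˡ walkEdges G p → Q f) →
             Σ (Walk G Q u v) λ q → walkEdges G q ≡ walkEdges G p
  restrict nil            Q-on-p = nil , refl
  restrict (cons e _ j p) Q-on-p with restrict p (Q-on-p ∘ there)
  ... | q , q≡p = cons e (Q-on-p (here refl)) j q , cong (e ∷_) q≡p

  splitAt : (p : Walk G E u v) → x ∈ˡ walkEdges G p →
            Σ (Fin n) λ a → Σ (Fin n) λ b → Σ (Walk G E u a) λ p₁ → Σ (Walk G E b v) λ p₂ →
              Joins G x a b × walkEdges G p ≡ walkEdges G p₁ ++ x ∷ walkEdges G p₂
  splitAt (cons e _  j p) (here refl) = _ , _ , nil , p , j , refl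
  splitAt (cons e Ee j p) (there x∈p) with splitAt p x∈p
  ... | a , b , p₁ , p₂ , jx , p≡ = a , b , cons e Ee j p₁ , p₂ , jx , cong (e ∷_) p≡

  orient : Joins G x a b → (q : Walk G E b a) →
           Σ (Walk G E (proj₁ (ends G x)) (proj₂ (ends G x))) λ r → walkEdges G r ↭ walkEdges G q
  orient (inj₁ refl) q = reverseʷ q , walkEdges-reverseʷ q
  orient (inj₂ refl) q = q , ↭-refl

  removeEdge : (p : Walk G E v v) → x ∈ˡ walkEdges G p →
               Σ (Walk G E (proj₁ (ends G x)) (proj₂ (ends G x))) λ r →
                 x ∷ walkEdges G r ↭ walkEdges G p
  removeEdge {x = x} p x∈p with splitAt p x∈p
  ... | a , b , p₁ , p₂ , jx , p≡ with orient jx (p₂ ++ʷ p₁)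
  ... | r , r↭ = r , (begin
    x ∷ walkEdges G r                          ↭⟨ ↭-prep x r↭ ⟩
    x ∷ walkEdges G (p₂ ++ʷ p₁)                ≡⟨ cong (x ∷_) (walkEdges-++ʷ p₂ p₁) ⟩
    x ∷ walkEdges G p₂ ++ walkEdges G p₁       ↭⟨ ↭-prep x (++-comm (walkEdges G p₂) _) ⟩
    x ∷ walkEdges G p₁ ++ walkEdges G p₂       ↭⟨ shift x (walkEdges G p₁) _ ⟨
    walkEdges G p₁ ++ x ∷ walkEdges G p₂       ≡⟨ p≡ ⟨
    walkEdges G p                              ∎)
    where open PermutationReasoning

module GreedySpanner {n m : ℕ} (G : WGraph n m) (ε : ℚ) (H : Subset m)
                     (greedy : IsGreedySpanner G ε H) where

  private
    σ : Permutation′ m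
    σ = proj₁ greedy
    variable
      e f x : Fin m
      v : Fin n

  rank : Fin m → Fin m
  rank f = σ ⟨$⟩ˡ f

  rank-injective : rank e ≡ rank f → e ≡ f
  rank-injective {e} {f} rank≡ = begin
    e                    ≡⟨ inverseʳ σ ⟨
    σ ⟨$⟩ʳ rank e        ≡⟨ cong (σ ⟨$⟩ʳ_) rank≡ ⟩
    σ ⟨$⟩ʳ rank f        ≡⟨ inverseʳ σ ⟩
    f                    ∎
    where open ≡-Reasoning

  w-mono-rank : rank e Fin.≤ rank f → w G e ≤ w G f
  w-mono-rank {e} {f} = subst₂ (λ e f → w G e ≤ w G f) (inverseʳ σ) (inverseʳ σ)
                      ∘ proj₁ (proj₂ greedy) (rank e) (rank f)

  Earlier : Fin m → Fin m → Set
  Earlier x f = f ∈ H × rank f Fin.< rank x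

  no-short-detour : x ∈ H → (q : Walk G (Earlier x) (proj₁ (ends G x)) (proj₂ (ends G x))) →
                    (1ℚ + ε) * w G x < walkWeight G q
  no-short-detour {x} x∈H q = ℚₚ.≰⇒> λ short → no-shortcut x∈H (q , short)
    where
    no-shortcut : x ∈ H → ¬ Σ (Walk G (Earlier x) (proj₁ (ends G x)) (proj₂ (ends G x)))
                               (λ q → walkWeight G q ≤ (1ℚ + ε) * w G x)
    no-shortcut = subst (λ y → y ∈ H → ¬ Σ (Walk G (Earlier x) (proj₁ (ends G y)) (proj₂ (ends G y)))
                                             (λ q → walkWeight G q ≤ (1ℚ + ε) * w G y))
                        (inverseʳ σ) (Equivalence.to (proj₂ (proj₂ greedy) (rank x)))

  open Data.List.Extrema (Finₚ.≤-totalOrder m) using (argmax; argmax-all; f[xs]≤f[argmax])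

  cycle-edge-bound : .{{NonNegative ((1ℚ + 1ℚ) + ε)}} →
                     (p : Walk G (_∈ H) v v) → Unique (walkEdges G p) → e ∈ˡ walkEdges G p →
                     ((1ℚ + 1ℚ) + ε) * w G e ≤ walkWeight G p
  cycle-edge-bound {e = e} p unique e∈p
    with removeEdge G p (argmax-all rank e∈p (All.tabulate id))
  ... | r , last∷r↭p = begin
    K * w G e                   ≤⟨ ℚₚ.*-monoˡ-≤-nonNeg K (w-mono-rank (rank≤last e∈p)) ⟩
    K * w G last                ≡⟨ K*a≡a+[1+ε]*a (w G last) ⟩
    w G last + (1ℚ + ε) * w G last
                                ≤⟨ ℚₚ.+-monoʳ-≤ (w G last) (ℚₚ.<⇒≤ (no-short-detour last∈H q)) ⟩
    w G last + walkWeight G q   ≡⟨ cong (λ es → w G last + sum (map (w G) es)) q≡r ⟩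
    w G last + walkWeight G r   ≡⟨ sum-↭ (↭ₚ.map⁺ (w G) last∷r↭p) ⟩
    walkWeight G p              ∎
    where
    open ℚₚ.≤-Reasoning
    K : ℚ
    K = (1ℚ + 1ℚ) + ε
    last : Fin m
    last = argmax rank e (walkEdges G p)

    K*a≡a+[1+ε]*a : ∀ a → K * a ≡ a + (1ℚ + ε) * a
    K*a≡a+[1+ε]*a = solve 2 (λ ε a → ((con 1ℚ :+ con 1ℚ) :+ ε) :* a := a :+ (con 1ℚ :+ ε) :* a) refl ε
      where open +-*-Solver

    rank≤last : f ∈ˡ walkEdges G p → rank f Fin.≤ rank last
    rank≤last = All.lookup (f[xs]≤f[argmax] {f = rank} e (walkEdges G p))

    last∈H : last ∈ H
    last∈H = walkEdges-satisfy G p (∈-resp-↭ last∷r↭p (here refl))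

    last∉r : All.All (last ≢_) (walkEdges G r)
    last∉r = AllPairs.head (Unique-resp-↭ (setoid (Fin m)) (↭⇒↭ₛ (↭-sym last∷r↭p)) unique)

    earlier : f ∈ˡ walkEdges G r → Earlier last f
    earlier f∈r = walkEdges-satisfy G p f∈p
                , Finₚ.≤∧≢⇒< (rank≤last f∈p) (All.lookup last∉r f∈r ∘ sym ∘ rank-injective)
      where f∈p = ∈-resp-↭ last∷r↭p (there f∈r)

    q : Walk G (Earlier last) (proj₁ (ends G last)) (proj₂ (ends G last))
    q = proj₁ (restrict G r earlier)
    q≡r : walkEdges G q ≡ walkEdges G r
    q≡r = proj₂ (restrict G r earlier)

module _ {n m : ℕ} (G : WGraph n m) where

  -- weight and sumDiff sum functions local to their where-blocks; these metas,
  -- solved by the refl proofs, give those summands names.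
  mutual
    weightTerm : Subset m → Fin m → ℚ
    weightTerm F = _

    weight≡sum : ∀ F → weight G F ≡ sum (map (weightTerm F) (allFin m))
    weight≡sum F = refl

  mutual
    sumDiffTerm : Subset m → Subset m → (Fin m → ℚ) → Fin m → ℚ
    sumDiffTerm H D c = _

    sumDiff≡sum : ∀ H D c → sumDiff G H D c ≡ sum (map (sumDiffTerm H D c) (allFin m))
    sumDiff≡sum H D c = refl

  charge-weight : NonNegWeights G → ∀ K .{{_ : NonNegative K}} (H D : Subset m) (c : Fin m → ℚ) →
                  (∀ e → e ∈ H → e ∉ D → K * w G e ≤ c e) →
                  K * weight G H ≤ sumDiff G H D c + K * weight G D
  charge-weight nonneg K H D c charged = begin
    K * weight G H                                    ≡⟨ cong (K *_) (weight≡sum H) ⟩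
    K * sum (map (weightTerm H) (allFin m))           ≡⟨ sum-map-*ˡ K (weightTerm H) (allFin m) ⟨
    sum (map (λ e → K * weightTerm H e) (allFin m))   ≤⟨ sum-map-mono charge (allFin m) ⟩
    sum (map (λ e → sumDiffTerm H D c e + K * weightTerm D e) (allFin m))
                                                      ≡⟨ sum-map-+ (sumDiffTerm H D c) _ (allFin m) ⟩
    sum (map (sumDiffTerm H D c) (allFin m)) + sum (map (λ e → K * weightTerm D e) (allFin m))
                                                      ≡⟨ cong₂ _+_ (sym (sumDiff≡sum H D c)) (sum-map-*ˡ K (weightTerm D) (allFin m)) ⟩
    sumDiff G H D c + K * sum (map (weightTerm D) (allFin m))
                                                      ≡⟨ cong (λ s → sumDiff G H D c + K * s) (weight≡sum D) ⟨
    sumDiff G H D c + K * weight G D                  ∎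
    where
    open ℚₚ.≤-Reasoning
    charge : ∀ e → K * weightTerm H e ≤ sumDiffTerm H D c e + K * weightTerm D e
    charge e with e ∈? H | e ∈? D
    ... | yes _   | yes _   = ℚₚ.≤-reflexive (sym (ℚₚ.+-identityˡ _))
    ... | yes e∈H | no  e∉D = ℚₚ.≤-trans (charged e e∈H e∉D)
      (ℚₚ.≤-reflexive (sym (trans (cong (c e +_) (ℚₚ.*-zeroʳ K)) (ℚₚ.+-identityʳ (c e)))))
    ... | no  _   | yes _   = ℚₚ.≤-trans (ℚₚ.*-monoˡ-≤-nonNeg K (nonneg e))
                                          (ℚₚ.≤-reflexive (sym (ℚₚ.+-identityˡ _)))
    ... | no  _   | no  _   = ℚₚ.≤-reflexive (sym (ℚₚ.+-identityˡ _))

[2+ε]a≤2a+[2+ε]b⇒a≤[1+2/ε]b : ∀ {ε a b} (ε>0 : 0ℚ < ε) →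
  ((1ℚ + 1ℚ) + ε) * a ≤ (1ℚ + 1ℚ) * a + ((1ℚ + 1ℚ) + ε) * b →
  a ≤ (1ℚ + (1ℚ + 1ℚ) * (1/ ε) {{>-nonZero ε>0}}) * b
[2+ε]a≤2a+[2+ε]b⇒a≤[1+2/ε]b {ε} {a} {b} ε>0 budget =
  ℚₚ.*-cancelˡ-≤-pos ε {{positive ε>0}} (begin
    ε * a                                               ≡⟨ ε*a≡[2+ε]*a-2*a ε a ⟩
    ((1ℚ + 1ℚ) + ε) * a - (1ℚ + 1ℚ) * a                 ≤⟨ ℚₚ.+-monoˡ-≤ (- ((1ℚ + 1ℚ) * a)) budget ⟩
    ((1ℚ + 1ℚ) * a + ((1ℚ + 1ℚ) + ε) * b) - (1ℚ + 1ℚ) * a ≡⟨ [c+d]-c≡d ((1ℚ + 1ℚ) * a) _ ⟩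
    ((1ℚ + 1ℚ) + ε) * b                                 ≡⟨ [2+ε]*b≡ε*[1+2i]*b ε (1/ ε) b (ℚₚ.*-inverseʳ ε) ⟩
    ε * ((1ℚ + (1ℚ + 1ℚ) * (1/ ε)) * b)                 ∎)
  where
  instance
    ε≢0 : NonZero ε
    ε≢0 = >-nonZero ε>0
  open ℚₚ.≤-Reasoning
  open +-*-Solver
  ε*a≡[2+ε]*a-2*a : ∀ ε a → ε * a ≡ ((1ℚ + 1ℚ) + ε) * a - (1ℚ + 1ℚ) * a
  ε*a≡[2+ε]*a-2*a = solve 2 (λ ε a → ε :* a := ((con 1ℚ :+ con 1ℚ) :+ ε) :* a :- (con 1ℚ :+ con 1ℚ) :* a) refl
  [c+d]-c≡d : ∀ c d → (c + d) - c ≡ d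
  [c+d]-c≡d = solve 2 (λ c d → (c :+ d) :- c := d) refl
  [2+ε]*b≡ε*[1+2i]*b : ∀ ε i b → ε * i ≡ 1ℚ → ((1ℚ + 1ℚ) + ε) * b ≡ ε * ((1ℚ + (1ℚ + 1ℚ) * i) * b)
  [2+ε]*b≡ε*[1+2i]*b ε i b ε*i≡1 = begin-equality
    ((1ℚ + 1ℚ) + ε) * b                     ≡⟨ cong (λ t → ((1ℚ + 1ℚ) * t + ε) * b) ε*i≡1 ⟨
    ((1ℚ + 1ℚ) * (ε * i) + ε) * b           ≡⟨ solve 3 (λ ε i b → ((con 1ℚ :+ con 1ℚ) :* (ε :* i) :+ ε) :* b
                                                      := ε :* ((con 1ℚ :+ (con 1ℚ :+ con 1ℚ) :* i) :* b)) refl ε i b ⟩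
    ε * ((1ℚ + (1ℚ + 1ℚ) * i) * b)          ∎

lemma21 : {n m : ℕ} (G : WGraph n m) → Connected G → NonNegWeights G →
    (ε : ℚ) (ε>0 : 0ℚ < ε) (H : Subset m) → IsGreedySpanner G ε H →
    (D : Subset m) →
    (C : Fin m → Σ (Fin n) (λ v → Walk G (_∈ H) v v)) →
    (∀ e → e ∈ H → e ∉ D →
      IsCycle G (Σ.proj₂ (C e)) × (e ∈ˡ walkEdges G (Σ.proj₂ (C e)))) →
    sumDiff G H D (λ e → walkWeight G (Σ.proj₂ (C e))) ≤ (1ℚ + 1ℚ) * weight G H →
    weight G H ≤ (1ℚ + (1ℚ + 1ℚ) * (1/ ε) {{>-nonZero ε>0}}) * weight G D
lemma21 G _ nonneg ε ε>0 H greedy D C cycles budget =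
  [2+ε]a≤2a+[2+ε]b⇒a≤[1+2/ε]b ε>0 (begin
    K * weight G H                     ≤⟨ charge-weight G nonneg K H D cycleWeight charged ⟩
    sumDiff G H D cycleWeight + K * weight G D
                                       ≤⟨ ℚₚ.+-monoˡ-≤ (K * weight G D) budget ⟩
    (1ℚ + 1ℚ) * weight G H + K * weight G D ∎)
  where
  open ℚₚ.≤-Reasoning
  K : ℚ
  K = (1ℚ + 1ℚ) + ε

  instance
    K≥0 : NonNegative K
    K≥0 = ℚₚ.pos⇒nonNeg K {{ℚₚ.nonNeg+pos⇒pos (1ℚ + 1ℚ) ε {{positive ε>0}}}}

  cycleWeight : Fin _ → ℚ
  cycleWeight e = walkWeight G (proj₂ (C e))

  charged : ∀ e → e ∈ H → e ∉ D → K * w G e ≤ cycleWeight e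
  charged e e∈H e∉D with cycles e e∈H e∉D
  ... | (_ , edges-distinct , _) , e∈Cₑ =
    GreedySpanner.cycle-edge-bound G ε H greedy (proj₂ (C e)) edges-distinct e∈Cₑ
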